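{- Let $F$ be a transition formula over $X$. Then for every $t\in\mathbb{N}$, $F^t\models_{\mathbf{LIRR}}F^\star$.
   Context: $X$ is a finite set of symbols, $X'=\{x':x\in X\}$ primed copies. A transition formula is a ground $\sigma^Z_{or}(X\cup X')$-formula, where $\sigma^Z_{or}$ is the ordered-ring signature ($+,\cdot,0,1,=,\le$) plus a unary predicate $\mathit{Int}$. Composition: $F\circ G=\exists X''.\,F[X'\mapsto X'']\land G[X\mapsto X'']$ with fresh $X''$; $F^t=F\circ\dots\circ F$ ($t$ times), $F^0$ being $\bigwedge_{x\in X}x'=x$. $\mathbf{LIRR}$: commutative ring axioms; $\le$ reflexive, transitive, antisymmetric; $x\le y\Rightarrow x+z\le y+z$; $0\le1\land0\ne1$; for each integer $n\ge1$, $\exists x\,(nx=1)$ and $\forall x\,(0\le nx\Rightarrow0\le x)$ ($nx$ meaning $n$-fold sum); $\mathit{Int}(1)$; $\mathit{Int}$ closed under $+$ and additive inverses; for integers $n>0$, $m$: $\forall x(\mathit{Int}(x)\land0\le nx+m\Rightarrow0\le x+\lfloor m/n\rfloor)$. Let $\mathrm{Cn}(F)=\{p\in\mathbb{Q}[X\cup X']:F\models_{\mathbf{LIRR}}0\le p\}$. $(\cdot)'$ is the ring homomorphism $\mathbb{Q}[X]\to\mathbb{Q}[X']$, $x\mapsto x'$. $\mathrm{LinInv}(F)=\{k\in\mathrm{span}_{\mathbb{Q}}(X):F\models_{\mathbf{LIRR}}k'=k\}$, with basis $a_1,\dots,a_n$. Let $D=\{d_x:x\in X\}$, $K=\{k_1,\dots,k_n\}$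 be fresh variables; $\delta:\mathbb{Q}[D]\to\mathbb{Q}[X\cup X']$, $d_x\mapsto x-x'$; $\mathit{inv}:\mathbb{Q}[K]\to\mathbb{Q}[X]$, $k_i\mapsto a_i$; $\delta_{inv}:\mathbb{Q}[D\cup K]\to\mathbb{Q}[X\cup X']$ their common extension (ring homomorphisms). Every $p\in\mathrm{span}_{\mathbb{Q}}(D)+\mathbb{Q}[K]$ is uniquely $p=\pi_D(p)+\pi_K(p)$ with $\pi_D(p)\in\mathrm{span}_{\mathbb{Q}}(D)$, $\pi_K(p)\in\mathbb{Q}[K]$. Let $V\subseteq\mathbb{Q}[K]$, $R\subseteq\mathrm{span}_{\mathbb{Q}}(D)+\mathbb{Q}[K]$ be the finite sets produced by the paper's algorithm, which satisfy $\mathbb{Q}[K]\cdot V+\mathrm{cone}(R)=\delta_{inv}^{ -1}(\mathrm{Cn}(F))\cap(\mathrm{span}_{\mathbb{Q}}(D)+\mathbb{Q}[K])$ ($\mathrm{cone}$: non-negative rational combinations) and $F\models_{\mathbf{LIRR}}\delta_{inv}(v)=0$ for all $v\in V$. For a fresh constant $t$, $\mathit{cf}(p)=\delta(\pi_D(p))+t\cdot\mathit{inv}(\pi_K(p))$, $\exp(F,t)=\bigwedge_{v\in V}0=\mathit{cf}(v)\land\bigwedge_{r\in R}0\le\mathit{cf}(r)$, and $F^\star=\exists t.\,\mathit{Int}(t)\land t\ge0\land\exp(F,t)$. -}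

module Defs where

open import Data.Nat using (ℕ; zero; suc)
open import Data.Integer as ℤ using (ℤ; +_; -[1+_]; _/ℕ_)
open import Data.Rational as ℚ using (ℚ; 0ℚ; 1ℚ)
open import Data.Fin using (Fin; zero; suc)
open import Data.Sum using (_⊎_; inj₁; inj₂; [_,_])
open import Data.Product using (Σ; _×_; _,_)
open import Data.Unit using (⊤)
open import Data.Empty using (⊥)
open import Relation.Nullary using (¬_)
open import Relation.Binary.PropositionalEquality using (_≡_)

-- Syntax: terms and first-order formulas over a set of symbols V.
-- Terms: variables/constants, rational constants, +, ·.
-- (The ring signature's 0 and 1 are  cst 0ℚ  and  cst 1ℚ.)

data Term (V : Set) : Set where
  var : V → Term V
  cst : ℚ → Term V
  _⊕_ : Term V → Term V → Term V
  _⊛_ : Term V → Term V → Term V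

infixl 6 _⊕_
infixl 7 _⊛_

data Formula (V : Set) : Set where
  ⊤ᶠ ⊥ᶠ : Formula V
  _≐_ _≼_ : Term V → Term V → Formula V
  Intᶠ    : Term V → Formula V
  _∧ᶠ_ _∨ᶠ_ _⇒ᶠ_ : Formula V → Formula V → Formula V
  ∃ᶠ ∀ᶠ : (k : ℕ) → Formula (V ⊎ Fin k) → Formula V

infix 4 _≐_ _≼_
infixr 3 _∧ᶠ_
infixr 2 _∨ᶠ_
infixr 1 _⇒ᶠ_

-- A formula is a σ^Z_or-formula if its only constants are 0 and 1.
data PureT {V : Set} : Term V → Set where
  var : ∀ x → PureT (var x)
  zero : PureT (cst 0ℚ)
  one  : PureT (cst 1ℚ)
  _⊕_ : ∀ {s t} → PureT s → PureT t → PureT (s ⊕ t)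
  _⊛_ : ∀ {s t} → PureT s → PureT t → PureT (s ⊛ t)

data PureF : {V : Set} → Formula V → Set₁ where
  ⊤ᶠ : ∀ {V} → PureF {V} ⊤ᶠ
  ⊥ᶠ : ∀ {V} → PureF {V} ⊥ᶠ
  _≐_ : ∀ {V} {s t : Term V} → PureT s → PureT t → PureF (s ≐ t)
  _≼_ : ∀ {V} {s t : Term V} → PureT s → PureT t → PureF (s ≼ t)
  Intᶠ : ∀ {V} {s : Term V} → PureT s → PureF (Intᶠ s)
  _∧ᶠ_ : ∀ {V} {φ ψ : Formula V} → PureF φ → PureF ψ → PureF (φ ∧ᶠ ψ)
  _∨ᶠ_ : ∀ {V} {φ ψ : Formula V} → PureF φ → PureF ψ → PureF (φ ∨ᶠ ψ)
  _⇒ᶠ_ : ∀ {V} {φ ψ : Formula V} → PureF φ → PureF ψ → PureF (φ ⇒ᶠ ψ)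
  ∃ᶠ : ∀ {V} k {φ : Formula (V ⊎ Fin k)} → PureF φ → PureF (∃ᶠ k φ)
  ∀ᶠ : ∀ {V} k {φ : Formula (V ⊎ Fin k)} → PureF φ → PureF (∀ᶠ k φ)

mapV : {V W : Set} {k : ℕ} → (V → W) → V ⊎ Fin k → W ⊎ Fin k
mapV f (inj₁ x) = inj₁ (f x)
mapV f (inj₂ i) = inj₂ i

renT : {V W : Set} → (V → W) → Term V → Term W
renT f (var x) = var (f x)
renT f (cst q) = cst q
renT f (s ⊕ t) = renT f s ⊕ renT f t
renT f (s ⊛ t) = renT f s ⊛ renT f t

ren : {V W : Set} → (V → W) → Formula V → Formula W
ren f ⊤ᶠ = ⊤ᶠ
ren f ⊥ᶠ = ⊥ᶠ
ren f (s ≐ t) = renT f s ≐ renT f t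
ren f (s ≼ t) = renT f s ≼ renT f t
ren f (Intᶠ s) = Intᶠ (renT f s)
ren f (φ ∧ᶠ ψ) = ren f φ ∧ᶠ ren f ψ
ren f (φ ∨ᶠ ψ) = ren f φ ∨ᶠ ren f ψ
ren f (φ ⇒ᶠ ψ) = ren f φ ⇒ᶠ ren f ψ
ren f (∃ᶠ k φ) = ∃ᶠ k (ren (mapV f) φ)
ren f (∀ᶠ k φ) = ∀ᶠ k (ren (mapV f) φ)

substT : {V W : Set} → (V → Term W) → Term V → Term W
substT σ (var x) = σ x
substT σ (cst q) = cst q
substT σ (s ⊕ t) = substT σ s ⊕ substT σ t
substT σ (s ⊛ t) = substT σ s ⊛ substT σ t

_⊖_ : {V : Set} → Term V → Term V → Term V
s ⊖ t = s ⊕ cst (ℚ.- 1ℚ) ⊛ t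

∑T : {V : Set} (k : ℕ) → (Fin k → Term V) → Term V
∑T zero f = cst 0ℚ
∑T (suc k) f = f zero ⊕ ∑T k (λ i → f (suc i))

∑ℚ : (k : ℕ) → (Fin k → ℚ) → ℚ
∑ℚ zero f = 0ℚ
∑ℚ (suc k) f = f zero ℚ.+ ∑ℚ k (λ i → f (suc i))

⋀ : {V : Set} (k : ℕ) → (Fin k → Formula V) → Formula V
⋀ zero f = ⊤ᶠ
⋀ (suc k) f = f zero ∧ᶠ ⋀ k (λ i → f (suc i))

nsum : {C : Set} → C → (C → C → C) → ℕ → C → C
nsum z _+_ zero x = z
nsum z _+_ (suc n) x = x + nsum z _+_ n x

intC : {C : Set} → C → C → (C → C → C) → (C → C) → ℤ → C
intC z o _+_ -_ (+ n) = nsum z _+_ n o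
intC z o _+_ -_ -[1+ n ] = - nsum z _+_ (suc n) o

record LIRR : Set₁ where
  field
    Carrier : Set
    0# 1# : Carrier
    _+_ _*_ : Carrier → Carrier → Carrier
    -_ : Carrier → Carrier
    _≤_ : Carrier → Carrier → Set
    Int : Carrier → Set
    -- witnesses of  ∃x (n x = 1)  (unique in a ring)
    recip : ℕ → Carrier
  infixl 6 _+_
  infixl 7 _*_
  infix 4 _≤_
  ι : ℤ → Carrier
  ι = intC 0# 1# _+_ -_
  field
    +-assoc : ∀ x y z → (x + y) + z ≡ x + (y + z)
    +-comm : ∀ x y → x + y ≡ y + x
    +-identityʳ : ∀ x → x + 0# ≡ x
    +-inverseʳ : ∀ x → x + (- x) ≡ 0#
    *-assoc : ∀ x y z → (x * y) * z ≡ x * (y * z)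
    *-comm : ∀ x y → x * y ≡ y * x
    *-identityʳ : ∀ x → x * 1# ≡ x
    distribˡ : ∀ x y z → x * (y + z) ≡ x * y + x * z
    ≤-refl : ∀ x → x ≤ x
    ≤-trans : ∀ x y z → x ≤ y → y ≤ z → x ≤ z
    ≤-antisym : ∀ x y → x ≤ y → y ≤ x → x ≡ y
    +-mono : ∀ x y z → x ≤ y → x + z ≤ y + z
    0≤1 : 0# ≤ 1#
    0≢1 : ¬ (0# ≡ 1#)
    recip-spec : ∀ k → nsum 0# _+_ (suc k) (recip k) ≡ 1#
    div-pos : ∀ k x → 0# ≤ nsum 0# _+_ (suc k) x → 0# ≤ x
    Int-1 : Int 1#
    Int-+ : ∀ x y → Int x → Int y → Int (x + y)
    Int-neg : ∀ x → Int x → Int (- x)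
    Int-floor : ∀ k (m : ℤ) x → Int x →
      0# ≤ nsum 0# _+_ (suc k) x + ι m → 0# ≤ x + ι (m /ℕ suc k)

open LIRR

⟦_⟧t : {V : Set} → Term V → (M : LIRR) → (V → Carrier M) → Carrier M
⟦ var x ⟧t M ρ = ρ x
⟦ cst q ⟧t M ρ = _*_ M (ι M (ℚ.numerator q)) (recip M (ℚ.denominator-1 q))
⟦ s ⊕ t ⟧t M ρ = _+_ M (⟦ s ⟧t M ρ) (⟦ t ⟧t M ρ)
⟦ s ⊛ t ⟧t M ρ = _*_ M (⟦ s ⟧t M ρ) (⟦ t ⟧t M ρ)

⟦_⟧ : {V : Set} → Formula V → (M : LIRR) → (V → Carrier M) → Set
⟦ ⊤ᶠ ⟧ M ρ = ⊤
⟦ ⊥ᶠ ⟧ M ρ = ⊥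
⟦ s ≐ t ⟧ M ρ = ⟦ s ⟧t M ρ ≡ ⟦ t ⟧t M ρ
⟦ s ≼ t ⟧ M ρ = _≤_ M (⟦ s ⟧t M ρ) (⟦ t ⟧t M ρ)
⟦ Intᶠ s ⟧ M ρ = Int M (⟦ s ⟧t M ρ)
⟦ φ ∧ᶠ ψ ⟧ M ρ = ⟦ φ ⟧ M ρ × ⟦ ψ ⟧ M ρ
⟦ φ ∨ᶠ ψ ⟧ M ρ = ⟦ φ ⟧ M ρ ⊎ ⟦ ψ ⟧ M ρ
⟦ φ ⇒ᶠ ψ ⟧ M ρ = ⟦ φ ⟧ M ρ → ⟦ ψ ⟧ M ρ
⟦ ∃ᶠ k φ ⟧ M ρ = Σ (Fin k → Carrier M) (λ w → ⟦ φ ⟧ M [ ρ , w ])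
⟦ ∀ᶠ k φ ⟧ M ρ = (w : Fin k → Carrier M) → ⟦ φ ⟧ M [ ρ , w ]

_⊨_ : {V : Set} → Formula V → Formula V → Set₁
φ ⊨ ψ = (M : LIRR) (ρ : _ → Carrier M) → ⟦ φ ⟧ M ρ → ⟦ ψ ⟧ M ρ

-- Transition formulas over X = Fin n:  symbols X ⊎ X'  (inj₁ x = x, inj₂ x = x')

Sym : ℕ → Set
Sym n = Fin n ⊎ Fin n

TF : ℕ → Set
TF n = Formula (Sym n)

xv x'v : {n : ℕ} → Fin n → Term (Sym n)
xv x = var (inj₁ x)
x'v x = var (inj₂ x)

-- F ∘ G = ∃X''. F[X' ↦ X''] ∧ G[X ↦ X'']
_∘ᶠ_ : {n : ℕ} → TF n → TF n → TF n
_∘ᶠ_ {n} F G = ∃ᶠ n (ren fF F ∧ᶠ ren fG G)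
  where
  fF : Sym n → Sym n ⊎ Fin n
  fF (inj₁ x) = inj₁ (inj₁ x)
  fF (inj₂ x) = inj₂ x
  fG : Sym n → Sym n ⊎ Fin n
  fG (inj₁ x) = inj₂ x
  fG (inj₂ x) = inj₁ (inj₂ x)

_^ᶠ_ : {n : ℕ} → TF n → ℕ → TF n
_^ᶠ_ {n} F zero = ⋀ n (λ x → x'v x ≐ xv x)
F ^ᶠ suc t = F ∘ᶠ (F ^ᶠ t)

linT : {n : ℕ} {W : Set} → (Fin n → ℚ) → (Fin n → Term W) → Term W
linT {n} c f = ∑T n (λ x → cst (c x) ⊛ f x)

InLinInv : {n : ℕ} → TF n → (Fin n → ℚ) → Set₁
InLinInv F k = F ⊨ (linT k x'v ≐ linT k xv)

IsBasisLinInv : {n m : ℕ} → TF n → (Fin m → Fin n → ℚ) → Set₁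
IsBasisLinInv {n} {m} F a =
  ((i : Fin m) → InLinInv F (a i)) ×
  ((c : Fin m → ℚ) → ((x : Fin n) → ∑ℚ m (λ i → c i ℚ.* a i x) ≡ 0ℚ) →
     (i : Fin m) → c i ≡ 0ℚ) ×
  ((k : Fin n → ℚ) → InLinInv F k →
     Σ (Fin m → ℚ) (λ c → (x : Fin n) → k x ≡ ∑ℚ m (λ i → c i ℚ.* a i x)))

-- Polynomial rings: ℚ[K] as terms modulo the commutative-ring congruence
-- (free commutative ℚ-algebra on K).

data _≈P_ {V : Set} : Term V → Term V → Set where
  refl≈ : ∀ {p} → p ≈P p
  sym≈ : ∀ {p q} → p ≈P q → q ≈P p
  trans≈ : ∀ {p q r} → p ≈P q → q ≈P r → p ≈P r
  ⊕-cong : ∀ {p p' q q'} → p ≈P p' → q ≈P q' → (p ⊕ q) ≈P (p' ⊕ q')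
  ⊛-cong : ∀ {p p' q q'} → p ≈P p' → q ≈P q' → (p ⊛ q) ≈P (p' ⊛ q')
  ⊕-assoc : ∀ p q r → ((p ⊕ q) ⊕ r) ≈P (p ⊕ (q ⊕ r))
  ⊕-comm : ∀ p q → (p ⊕ q) ≈P (q ⊕ p)
  ⊕-identity : ∀ p → (p ⊕ cst 0ℚ) ≈P p
  ⊕-inverse : ∀ p → (p ⊕ cst (ℚ.- 1ℚ) ⊛ p) ≈P cst 0ℚ
  ⊛-assoc : ∀ p q r → ((p ⊛ q) ⊛ r) ≈P (p ⊛ (q ⊛ r))
  ⊛-comm : ∀ p q → (p ⊛ q) ≈P (q ⊛ p)
  ⊛-identity : ∀ p → (p ⊛ cst 1ℚ) ≈P p
  distrib : ∀ p q r → (p ⊛ (q ⊕ r)) ≈P ((p ⊛ q) ⊕ (p ⊛ r))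
  cst-+ : ∀ a b → (cst a ⊕ cst b) ≈P cst (a ℚ.+ b)
  cst-* : ∀ a b → (cst a ⊛ cst b) ≈P cst (a ℚ.* b)

-- Elements of span_ℚ(D) + ℚ[K], given by their two components
-- π_D (coefficients of d_x) and π_K (a polynomial in k_1..k_m).
record DK (n m : ℕ) : Set where
  constructor dk
  field
    πD : Fin n → ℚ
    πK : Term (Fin m)
open DK public

module _ {n m : ℕ} (a : Fin m → Fin n → ℚ) where

  invT : Term (Fin m) → Term (Sym n)
  invT = substT (λ i → linT (a i) xv)

  δT : (Fin n → ℚ) → Term (Sym n)
  δT c = linT c (λ x → xv x ⊖ x'v x)

  δinv : DK n m → Term (Sym n)
  δinv p = δT (πD p) ⊕ invT (πK p)

  -- p ∈ ℚ[K]·V + cone(R)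
  InGen : {nv nr : ℕ} → (Fin nv → Term (Fin m)) → (Fin nr → DK n m) → DK n m → Set
  InGen {nv} {nr} V R p =
    Σ (Fin nv → Term (Fin m)) (λ q →
    Σ (Fin nr → ℚ) (λ λr →
      ((j : Fin nr) → 0ℚ ℚ.≤ λr j) ×
      ((x : Fin n) → πD p x ≡ ∑ℚ nr (λ j → λr j ℚ.* πD (R j) x)) ×
      (πK p ≈P (∑T nv (λ j → q j ⊛ V j) ⊕ ∑T nr (λ j → cst (λr j) ⊛ πK (R j))))))

  -- symbols of F* body: X ⊎ X' ⊎ {t}
  tv : Term (Sym n ⊎ Fin 1)
  tv = var (inj₂ zero)

  cf : DK n m → Term (Sym n ⊎ Fin 1)
  cf p = renT inj₁ (δT (πD p)) ⊕ tv ⊛ renT inj₁ (invT (πK p))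

  expF : {nv nr : ℕ} → (Fin nv → Term (Fin m)) → (Fin nr → DK n m) →
         Formula (Sym n ⊎ Fin 1)
  expF {nv} {nr} V R =
    ⋀ nv (λ j → cst 0ℚ ≐ cf (dk (λ _ → 0ℚ) (V j))) ∧ᶠ
    ⋀ nr (λ j → cst 0ℚ ≼ cf (R j))

  star : {nv nr : ℕ} → (Fin nv → Term (Fin m)) → (Fin nr → DK n m) → TF n
  star V R = ∃ᶠ 1 (Intᶠ tv ∧ᶠ (cst 0ℚ ≼ tv) ∧ᶠ expF V R)

{-# OPTIONS --safe #-}
module Submission where

open import Defs
open import Level using (0ℓ)
open import Algebra.Bundles using (CommutativeRing; Semiring)
open import Algebra.Structures using (IsCommutativeRing)
import Algebra.Consequences.Setoid as Consequences
open import Algebra.Consequences.Propositional using (comm∧assoc⇒middleFour)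
import Algebra.Definitions as Definitions
import Algebra.Properties.Ring as RingProperties
import Algebra.Properties.Semiring.Sum as SemiringSum
open import Data.Nat using (ℕ; zero; suc)
import Data.Integer as ℤ
open import Data.Fin using (Fin; zero; suc)
open import Data.Product using (Σ-syntax; _×_; _,_; proj₁)
open import Data.Sum using (_⊎_; inj₁; inj₂; [_,_]′)
open import Data.Unit using (tt)
open import Data.Rational as ℚ using (ℚ; 0ℚ; 1ℚ)
import Data.Rational.Properties as ℚ
open import Function using (_∘_)
open import Relation.Binary using (Rel; Setoid; IsEquivalence)
import Relation.Binary.Reasoning.Setoid as SetoidReasoning
open import Relation.Binary.PropositionalEquality
  using (_≡_; refl; sym; trans; cong; cong₂; subst; subst₂; isEquivalence; module ≡-Reasoning)

-- The bound variable t of F* is witnessed by the number t of steps itself. Each generator r of R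
-- holds on every single step (x, w) of F: 0 ≤ δ(π_D r)(x, w) + inv(π_K r)(x). Along a path
-- x = w₀ → w₁ → … → w_t = x' of F the δ-parts telescope to δ(π_D r)(x, x'), while
-- inv(π_K r)(wᵢ) = inv(π_K r)(x) for every i because the aᵢ are linear invariants of F; adding the
-- t inequalities gives 0 ≤ cf(r). For v ∈ V, t · inv(v)(x) = 0: when t ≥ 1 the first step already
-- forces inv(v)(x) = 0.

module RightBiased {A : Set} {_≈_ : Rel A 0ℓ} (≈-isEquivalence : IsEquivalence _≈_) where
  open Definitions _≈_

  private
    ≈-setoid : Setoid 0ℓ 0ℓ
    ≈-setoid = record { isEquivalence = ≈-isEquivalence }

  open Consequences ≈-setoid

  isCommutativeRingʳ : {_+_ _*_ : A → A → A} { -_ : A → A} {0# 1# : A} →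
    Congruent₂ _+_ → Congruent₂ _*_ → Congruent₁ -_ →
    Associative _+_ → Commutative _+_ → RightIdentity 0# _+_ → RightInverse 0# -_ _+_ →
    Associative _*_ → Commutative _*_ → RightIdentity 1# _*_ → _*_ DistributesOverˡ _+_ →
    IsCommutativeRing _≈_ _+_ _*_ -_ 0# 1#
  isCommutativeRingʳ +-cong *-cong -‿cong +-assoc +-comm +-identityʳ +-inverseʳ
                     *-assoc *-comm *-identityʳ distribˡ = record
    { isRing = record
      { +-isAbelianGroup = record
        { isGroup = record
          { isMonoid = record
            { isSemigroup = record
              { isMagma = record { isEquivalence = ≈-isEquivalence ; ∙-cong = +-cong }
              ; assoc = +-assoc
              }
            ; identity = comm∧idʳ⇒id +-comm +-identityʳ
            }
          ; inverse = comm∧invʳ⇒inv +-comm +-inverseʳ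
          ; ⁻¹-cong = -‿cong
          }
        ; comm = +-comm
        }
      ; *-cong = *-cong
      ; *-assoc = *-assoc
      ; *-identity = comm∧idʳ⇒id *-comm *-identityʳ
      ; distrib = comm∧distrˡ⇒distr +-cong *-comm distribˡ
      }
    ; *-comm = *-comm
    }

open RightBiased using (isCommutativeRingʳ)

lirrRing : LIRR → CommutativeRing 0ℓ 0ℓ
lirrRing M = record
  { isCommutativeRing = isCommutativeRingʳ isEquivalence (cong₂ _+_) (cong₂ _*_) (cong -_)
      +-assoc +-comm +-identityʳ +-inverseʳ *-assoc *-comm *-identityʳ distribˡ
  }
  where open LIRR M

polynomialRing : Set → CommutativeRing 0ℓ 0ℓ
polynomialRing V = record
  { Carrier = Term V
  ; _≈_ = _≈P_
  ; -_ = cst (ℚ.- 1ℚ) ⊛_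
  ; isCommutativeRing = isCommutativeRingʳ ≈P-isEquivalence ⊕-cong ⊛-cong (⊛-cong refl≈)
      ⊕-assoc ⊕-comm ⊕-identity ⊕-inverse ⊛-assoc ⊛-comm ⊛-identity distrib
  }
  where
  ≈P-isEquivalence : IsEquivalence (_≈P_ {V})
  ≈P-isEquivalence = record { refl = refl≈ ; sym = sym≈ ; trans = trans≈ }

module Indicator {c ℓ} (S : Semiring c ℓ) where
  open Semiring S
    using ( Carrier; _≈_; _+_; _*_; 0#; 1#; setoid
          ; +-cong; +-congˡ; *-identityˡ; zeroˡ; +-identityˡ; +-identityʳ)
  open SemiringSum S using (sum; sum-cong-≋; sum-replicate-zero)
  open SetoidReasoning setoid

  indicator : {k : ℕ} → Fin k → Fin k → Carrier
  indicator zero    zero    = 1#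
  indicator zero    (suc _) = 0#
  indicator (suc _) zero    = 0#
  indicator (suc i) (suc j) = indicator i j

  sum-indicator : {k : ℕ} (i : Fin k) (g : Fin k → Carrier) →
    sum (λ j → indicator i j * g j) ≈ g i
  sum-indicator {suc k} zero g = begin
    1# * g zero + sum (λ j → 0# * g (suc j))
      ≈⟨ +-cong (*-identityˡ _) (sum-cong-≋ {k} (zeroˡ ∘ g ∘ suc)) ⟩
    g zero + sum {k} (λ _ → 0#)
      ≈⟨ +-congˡ (sum-replicate-zero k) ⟩
    g zero + 0#
      ≈⟨ +-identityʳ _ ⟩
    g zero ∎
  sum-indicator {suc k} (suc i) g = begin
    0# * g zero + sum (λ j → indicator i j * g (suc j)) ≈⟨ +-cong (zeroˡ _) (sum-indicator i (g ∘ suc)) ⟩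
    0# + g (suc i)                                     ≈⟨ +-identityˡ _ ⟩
    g (suc i)                                          ∎

ℚ-semiring : Semiring 0ℓ 0ℓ
ℚ-semiring = CommutativeRing.semiring ℚ.+-*-commutativeRing

module ℚIndicator = Indicator ℚ-semiring
module TermIndicator (V : Set) = Indicator (CommutativeRing.semiring (polynomialRing V))

open ℚIndicator using (indicator)

indicator-nonneg : {k : ℕ} (i j : Fin k) → 0ℚ ℚ.≤ indicator i j
indicator-nonneg zero    zero    = ℚ.nonNegative⁻¹ 1ℚ
indicator-nonneg zero    (suc _) = ℚ.≤-refl
indicator-nonneg (suc _) zero    = ℚ.≤-refl
indicator-nonneg (suc i) (suc j) = indicator-nonneg i j

cst-indicator : {V : Set} {k : ℕ} (i j : Fin k) → cst {V} (indicator i j) ≈P TermIndicator.indicator V i j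
cst-indicator zero    zero    = refl≈
cst-indicator zero    (suc _) = refl≈
cst-indicator (suc _) zero    = refl≈
cst-indicator (suc i) (suc j) = cst-indicator i j

∑ℚ-sum : (k : ℕ) (f : Fin k → ℚ) → ∑ℚ k f ≡ SemiringSum.sum ℚ-semiring f
∑ℚ-sum zero    f = refl
∑ℚ-sum (suc k) f = cong (f zero ℚ.+_) (∑ℚ-sum k (f ∘ suc))

∑T-sum : {V : Set} (k : ℕ) (f : Fin k → Term V) →
  ∑T k f ≡ SemiringSum.sum (CommutativeRing.semiring (polynomialRing V)) f
∑T-sum zero    f = refl
∑T-sum (suc k) f = cong (f zero ⊕_) (∑T-sum k (f ∘ suc))

InGen-generator : {n m nv nr : ℕ} (a : Fin m → Fin n → ℚ)
  (V : Fin nv → Term (Fin m)) (R : Fin nr → DK n m) (j : Fin nr) → InGen a V R (R j)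
InGen-generator {m = m} {nv} {nr} a V R j =
  (λ _ → cst 0ℚ) , indicator j , indicator-nonneg j ,
  (λ x → sym (trans (∑ℚ-sum nr _) (ℚIndicator.sum-indicator j (λ j' → πD (R j') x)))) ,
  sym≈ πK-combination
  where
  open CommutativeRing (polynomialRing (Fin m))
    using (semiring; setoid; reflexive; +-cong; *-congʳ; zeroˡ; +-identityˡ)
  open SemiringSum semiring using (sum; sum-cong-≋; sum-replicate-zero)
  open TermIndicator (Fin m) using (sum-indicator)
  open SetoidReasoning setoid
  πK-combination : (∑T nv (λ j' → cst 0ℚ ⊛ V j') ⊕ ∑T nr (λ j' → cst (indicator j j') ⊛ πK (R j')))
                   ≈P πK (R j)
  πK-combination = begin
    ∑T nv (λ j' → cst 0ℚ ⊛ V j') ⊕ ∑T nr (λ j' → cst (indicator j j') ⊛ πK (R j'))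
      ≈⟨ +-cong (reflexive (∑T-sum nv _)) (reflexive (∑T-sum nr _)) ⟩
    sum (λ j' → cst 0ℚ ⊛ V j') ⊕ sum (λ j' → cst (indicator j j') ⊛ πK (R j'))
      ≈⟨ +-cong (trans≈ (sum-cong-≋ {nv} (zeroˡ ∘ V)) (sum-replicate-zero nv))
                (sum-cong-≋ {nr} (λ j' → *-congʳ (cst-indicator j j'))) ⟩
    cst 0ℚ ⊕ sum (λ j' → TermIndicator.indicator (Fin m) j j' ⊛ πK (R j'))
      ≈⟨ +-identityˡ _ ⟩
    sum (λ j' → TermIndicator.indicator (Fin m) j j' ⊛ πK (R j'))
      ≈⟨ sum-indicator j (πK ∘ R) ⟩
    πK (R j) ∎

module Semantics (M : LIRR) where
  open LIRR M
  open CommutativeRing (lirrRing M)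
    using (semiring; ring; _-_; zeroˡ; zeroʳ; +-identityˡ; *-identityˡ; distribʳ; -‿inverseˡ; -‿inverseʳ)
  open SemiringSum semiring using (sum; sum-cong-≗; ∑-distrib-+; sum-replicate-zero)
  open RingProperties ring using (-1*x≈-x)
  open ≡-Reasoning

  Valuation : Set → Set
  Valuation V = V → Carrier

  +-nonneg : {x y : Carrier} → 0# ≤ x → 0# ≤ y → 0# ≤ x + y
  +-nonneg {x} {y} 0≤x 0≤y =
    ≤-trans 0# y (x + y) 0≤y (subst (_≤ x + y) (+-identityˡ y) (+-mono 0# x y 0≤x))

  ι-nonneg : (t : ℕ) → 0# ≤ ι (ℤ.+ t)
  ι-nonneg zero    = ≤-refl 0#
  ι-nonneg (suc t) = +-nonneg 0≤1 (ι-nonneg t)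

  ι-Int : (t : ℕ) → Int (ι (ℤ.+ t))
  ι-Int zero    = subst Int (+-inverseʳ 1#) (Int-+ 1# (- 1#) Int-1 (Int-neg 1# Int-1))
  ι-Int (suc t) = Int-+ 1# _ Int-1 (ι-Int t)

  -‿telescope : (x y z : Carrier) → (x - y) + (y - z) ≡ x - z
  -‿telescope x y z = begin
    (x - y) + (y - z)   ≡⟨ +-assoc x (- y) (y - z) ⟩
    x + (- y + (y - z)) ≡⟨ cong (x +_) (sym (+-assoc (- y) y (- z))) ⟩
    x + ((- y + y) - z) ≡⟨ cong (λ u → x + (u - z)) (-‿inverseˡ y) ⟩
    x + (0# - z)        ≡⟨ cong (x +_) (+-identityˡ (- z)) ⟩
    x - z               ∎

  ⟦cst0⟧ : {V : Set} (ρ : Valuation V) → ⟦ cst 0ℚ ⟧t M ρ ≡ 0#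
  ⟦cst0⟧ _ = zeroˡ _

  ⟦cst-1⟧ : {V : Set} (ρ : Valuation V) → ⟦ cst (ℚ.- 1ℚ) ⟧t M ρ ≡ - 1#
  ⟦cst-1⟧ _ = begin
    - (1# + 0#) * recip 0 ≡⟨ cong₂ (λ u v → - u * v) (+-identityʳ 1#) recip0≡1 ⟩
    - 1# * 1#             ≡⟨ *-identityʳ (- 1#) ⟩
    - 1#                  ∎
    where
    recip0≡1 : recip 0 ≡ 1#
    recip0≡1 = trans (sym (+-identityʳ (recip 0))) (recip-spec 0)

  ⟦⊖⟧ : {V : Set} (s u : Term V) (ρ : Valuation V) → ⟦ s ⊖ u ⟧t M ρ ≡ ⟦ s ⟧t M ρ - ⟦ u ⟧t M ρ
  ⟦⊖⟧ s u ρ = cong (⟦ s ⟧t M ρ +_) (trans (cong (_* ⟦ u ⟧t M ρ) (⟦cst-1⟧ ρ)) (-1*x≈-x _))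

  ⟦∑T⟧ : {V : Set} (k : ℕ) (f : Fin k → Term V) (ρ : Valuation V) →
    ⟦ ∑T k f ⟧t M ρ ≡ sum (λ i → ⟦ f i ⟧t M ρ)
  ⟦∑T⟧ zero    f ρ = ⟦cst0⟧ ρ
  ⟦∑T⟧ (suc k) f ρ = cong (⟦ f zero ⟧t M ρ +_) (⟦∑T⟧ k (f ∘ suc) ρ)

  ⟦⟧t-cong : {V : Set} (s : Term V) {ρ σ : Valuation V} →
    (∀ v → ρ v ≡ σ v) → ⟦ s ⟧t M ρ ≡ ⟦ s ⟧t M σ
  ⟦⟧t-cong (var x) ρ≗σ = ρ≗σ x
  ⟦⟧t-cong (cst q) ρ≗σ = refl
  ⟦⟧t-cong (s ⊕ u) ρ≗σ = cong₂ _+_ (⟦⟧t-cong s ρ≗σ) (⟦⟧t-cong u ρ≗σ)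
  ⟦⟧t-cong (s ⊛ u) ρ≗σ = cong₂ _*_ (⟦⟧t-cong s ρ≗σ) (⟦⟧t-cong u ρ≗σ)

  ⟦renT⟧ : {V W : Set} (f : V → W) (s : Term V) {ρ : Valuation W} {σ : Valuation V} →
    (∀ v → ρ (f v) ≡ σ v) → ⟦ renT f s ⟧t M ρ ≡ ⟦ s ⟧t M σ
  ⟦renT⟧ f (var x) ρf≗σ = ρf≗σ x
  ⟦renT⟧ f (cst q) ρf≗σ = refl
  ⟦renT⟧ f (s ⊕ u) ρf≗σ = cong₂ _+_ (⟦renT⟧ f s ρf≗σ) (⟦renT⟧ f u ρf≗σ)
  ⟦renT⟧ f (s ⊛ u) ρf≗σ = cong₂ _*_ (⟦renT⟧ f s ρf≗σ) (⟦renT⟧ f u ρf≗σ)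

  ⟦substT⟧ : {V W : Set} (τ : V → Term W) (s : Term V) (ρ : Valuation W) →
    ⟦ substT τ s ⟧t M ρ ≡ ⟦ s ⟧t M (λ v → ⟦ τ v ⟧t M ρ)
  ⟦substT⟧ τ (var x) ρ = refl
  ⟦substT⟧ τ (cst q) ρ = refl
  ⟦substT⟧ τ (s ⊕ u) ρ = cong₂ _+_ (⟦substT⟧ τ s ρ) (⟦substT⟧ τ u ρ)
  ⟦substT⟧ τ (s ⊛ u) ρ = cong₂ _*_ (⟦substT⟧ τ s ρ) (⟦substT⟧ τ u ρ)

  mapV-valuation : {V W : Set} {k : ℕ} (f : V → W) {ρ : Valuation W} {σ : Valuation V}
    (w : Fin k → Carrier) → (∀ v → ρ (f v) ≡ σ v) → ∀ v → [ ρ , w ]′ (mapV f v) ≡ [ σ , w ]′ v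
  mapV-valuation f w ρf≗σ (inj₁ x) = ρf≗σ x
  mapV-valuation f w ρf≗σ (inj₂ i) = refl

  ⟦ren⟧→ : {V W : Set} (f : V → W) (φ : Formula V) {ρ : Valuation W} {σ : Valuation V} →
    (∀ v → ρ (f v) ≡ σ v) → ⟦ ren f φ ⟧ M ρ → ⟦ φ ⟧ M σ
  ⟦ren⟧← : {V W : Set} (f : V → W) (φ : Formula V) {ρ : Valuation W} {σ : Valuation V} →
    (∀ v → ρ (f v) ≡ σ v) → ⟦ φ ⟧ M σ → ⟦ ren f φ ⟧ M ρ
  ⟦ren⟧→ f ⊤ᶠ       h _             = tt
  ⟦ren⟧→ f (s ≐ u)  h s≡u           = trans (sym (⟦renT⟧ f s h)) (trans s≡u (⟦renT⟧ f u h))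
  ⟦ren⟧→ f (s ≼ u)  h s≤u           = subst₂ _≤_ (⟦renT⟧ f s h) (⟦renT⟧ f u h) s≤u
  ⟦ren⟧→ f (Intᶠ s) h Int-s         = subst Int (⟦renT⟧ f s h) Int-s
  ⟦ren⟧→ f (φ ∧ᶠ ψ) h (φ✓ , ψ✓)     = ⟦ren⟧→ f φ h φ✓ , ⟦ren⟧→ f ψ h ψ✓
  ⟦ren⟧→ f (φ ∨ᶠ ψ) h (inj₁ φ✓)     = inj₁ (⟦ren⟧→ f φ h φ✓)
  ⟦ren⟧→ f (φ ∨ᶠ ψ) h (inj₂ ψ✓)     = inj₂ (⟦ren⟧→ f ψ h ψ✓)
  ⟦ren⟧→ f (φ ⇒ᶠ ψ) h φ⇒ψ φ✓        = ⟦ren⟧→ f ψ h (φ⇒ψ (⟦ren⟧← f φ h φ✓))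
  ⟦ren⟧→ f (∃ᶠ k φ) h (w , φ✓)      = w , ⟦ren⟧→ (mapV f) φ (mapV-valuation f w h) φ✓
  ⟦ren⟧→ f (∀ᶠ k φ) h ∀φ w          = ⟦ren⟧→ (mapV f) φ (mapV-valuation f w h) (∀φ w)
  ⟦ren⟧← f ⊤ᶠ       h _             = tt
  ⟦ren⟧← f (s ≐ u)  h s≡u           = trans (⟦renT⟧ f s h) (trans s≡u (sym (⟦renT⟧ f u h)))
  ⟦ren⟧← f (s ≼ u)  h s≤u           = subst₂ _≤_ (sym (⟦renT⟧ f s h)) (sym (⟦renT⟧ f u h)) s≤u
  ⟦ren⟧← f (Intᶠ s) h Int-s         = subst Int (sym (⟦renT⟧ f s h)) Int-s
  ⟦ren⟧← f (φ ∧ᶠ ψ) h (φ✓ , ψ✓)     = ⟦ren⟧← f φ h φ✓ , ⟦ren⟧← f ψ h ψ✓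
  ⟦ren⟧← f (φ ∨ᶠ ψ) h (inj₁ φ✓)     = inj₁ (⟦ren⟧← f φ h φ✓)
  ⟦ren⟧← f (φ ∨ᶠ ψ) h (inj₂ ψ✓)     = inj₂ (⟦ren⟧← f ψ h ψ✓)
  ⟦ren⟧← f (φ ⇒ᶠ ψ) h φ⇒ψ φ✓        = ⟦ren⟧← f ψ h (φ⇒ψ (⟦ren⟧→ f φ h φ✓))
  ⟦ren⟧← f (∃ᶠ k φ) h (w , φ✓)      = w , ⟦ren⟧← (mapV f) φ (mapV-valuation f w h) φ✓
  ⟦ren⟧← f (∀ᶠ k φ) h ∀φ w          = ⟦ren⟧← (mapV f) φ (mapV-valuation f w h) (∀φ w)

  ⟦⋀⟧-intro : {V : Set} (k : ℕ) (φ : Fin k → Formula V) {ρ : Valuation V} →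
    (∀ i → ⟦ φ i ⟧ M ρ) → ⟦ ⋀ k φ ⟧ M ρ
  ⟦⋀⟧-intro zero    φ φ✓ = tt
  ⟦⋀⟧-intro (suc k) φ φ✓ = φ✓ zero , ⟦⋀⟧-intro k (φ ∘ suc) (φ✓ ∘ suc)

  ⟦⋀⟧-elim : {V : Set} (k : ℕ) (φ : Fin k → Formula V) {ρ : Valuation V} →
    ⟦ ⋀ k φ ⟧ M ρ → ∀ i → ⟦ φ i ⟧ M ρ
  ⟦⋀⟧-elim (suc k) φ (φ₀✓ , _)  zero    = φ₀✓
  ⟦⋀⟧-elim (suc k) φ (_ , φₛ✓) (suc i) = ⟦⋀⟧-elim k (φ ∘ suc) φₛ✓ i

  ∘ᶠ-midpoint : {n : ℕ} (F G : TF n) {ρ : Valuation (Sym n)} → ⟦ F ∘ᶠ G ⟧ M ρ →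
    Σ[ w ∈ (Fin n → Carrier) ] ⟦ F ⟧ M [ ρ ∘ inj₁ , w ]′ × ⟦ G ⟧ M [ w , ρ ∘ inj₂ ]′
  ∘ᶠ-midpoint F G (w , F✓ , G✓) =
    w , ⟦ren⟧→ _ F (λ { (inj₁ x) → refl ; (inj₂ x) → refl }) F✓
      , ⟦ren⟧→ _ G (λ { (inj₁ x) → refl ; (inj₂ x) → refl }) G✓

  ^ᶠ0-identity : {n : ℕ} (F : TF n) {ρ : Valuation (Sym n)} → ⟦ F ^ᶠ 0 ⟧ M ρ →
    ∀ x → ρ (inj₂ x) ≡ ρ (inj₁ x)
  ^ᶠ0-identity {n} F = ⟦⋀⟧-elim n _

  module _ {n m : ℕ} (a : Fin m → Fin n → ℚ) where

    ⟦δT⟧ : (c : Fin n → ℚ) (ρ : Valuation (Sym n)) →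
      ⟦ δT a c ⟧t M ρ ≡ sum (λ x → ⟦ cst (c x) ⟧t M ρ * (ρ (inj₁ x) - ρ (inj₂ x)))
    ⟦δT⟧ c ρ = trans (⟦∑T⟧ n (λ x → cst (c x) ⊛ (xv x ⊖ x'v x)) ρ)
                     (sum-cong-≗ {n} (λ x → cong (⟦ cst (c x) ⟧t M ρ *_) (⟦⊖⟧ (xv x) (x'v x) ρ)))

    δT-telescope : (c : Fin n → ℚ) (ρ : Valuation (Sym n)) (w : Fin n → Carrier) →
      ⟦ δT a c ⟧t M [ ρ ∘ inj₁ , w ]′ + ⟦ δT a c ⟧t M [ w , ρ ∘ inj₂ ]′ ≡ ⟦ δT a c ⟧t M ρ
    δT-telescope c ρ w = begin
      ⟦ δT a c ⟧t M [ ρ ∘ inj₁ , w ]′ + ⟦ δT a c ⟧t M [ w , ρ ∘ inj₂ ]′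
        ≡⟨ cong₂ _+_ (⟦δT⟧ c _) (⟦δT⟧ c _) ⟩
      sum (λ x → C x * (ρ (inj₁ x) - w x)) + sum (λ x → C x * (w x - ρ (inj₂ x)))
        ≡⟨ sym (∑-distrib-+ (λ x → C x * (ρ (inj₁ x) - w x)) (λ x → C x * (w x - ρ (inj₂ x)))) ⟩
      sum (λ x → C x * (ρ (inj₁ x) - w x) + C x * (w x - ρ (inj₂ x)))
        ≡⟨ sum-cong-≗ (λ x → trans (sym (distribˡ (C x) _ _))
                                   (cong (C x *_) (-‿telescope (ρ (inj₁ x)) (w x) (ρ (inj₂ x))))) ⟩
      sum (λ x → C x * (ρ (inj₁ x) - ρ (inj₂ x)))
        ≡⟨ sym (⟦δT⟧ c ρ) ⟩
      ⟦ δT a c ⟧t M ρ ∎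
      where
      C : Fin n → Carrier
      C x = ⟦ cst (c x) ⟧t M ρ

    δT-vanishes : (c : Fin n → ℚ) (ρ : Valuation (Sym n)) → (∀ x → ρ (inj₂ x) ≡ ρ (inj₁ x)) →
      ⟦ δT a c ⟧t M ρ ≡ 0#
    δT-vanishes c ρ x'≡x = begin
      ⟦ δT a c ⟧t M ρ                                             ≡⟨ ⟦δT⟧ c ρ ⟩
      sum (λ x → ⟦ cst (c x) ⟧t M ρ * (ρ (inj₁ x) - ρ (inj₂ x))) ≡⟨ sum-cong-≗ no-change ⟩
      sum {n} (λ _ → 0#)                                          ≡⟨ sum-replicate-zero n ⟩
      0#                                                          ∎
      where
      no-change : ∀ x → ⟦ cst (c x) ⟧t M ρ * (ρ (inj₁ x) - ρ (inj₂ x)) ≡ 0#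
      no-change x = begin
        C * (ρ (inj₁ x) - ρ (inj₂ x)) ≡⟨ cong (λ u → C * (ρ (inj₁ x) - u)) (x'≡x x) ⟩
        C * (ρ (inj₁ x) - ρ (inj₁ x)) ≡⟨ cong (C *_) (-‿inverseʳ (ρ (inj₁ x))) ⟩
        C * 0#                        ≡⟨ zeroʳ C ⟩
        0#                            ∎
        where
        C : Carrier
        C = ⟦ cst (c x) ⟧t M ρ

    δT-zero : (ρ : Valuation (Sym n)) → ⟦ δT a (λ _ → 0ℚ) ⟧t M ρ ≡ 0#
    δT-zero ρ = trans (⟦δT⟧ _ ρ)
      (trans (sum-cong-≗ {n} (λ x → trans (cong (_* (ρ (inj₁ x) - ρ (inj₂ x))) (⟦cst0⟧ ρ)) (zeroˡ _)))
             (sum-replicate-zero n))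

    invValuation : Valuation (Sym n) → Valuation (Fin m)
    invValuation ρ i = sum (λ x → ⟦ cst (a i x) ⟧t M ρ * ρ (inj₁ x))

    ⟦invT⟧ : (p : Term (Fin m)) (ρ : Valuation (Sym n)) →
      ⟦ invT a p ⟧t M ρ ≡ ⟦ p ⟧t M (invValuation ρ)
    ⟦invT⟧ p ρ = trans (⟦substT⟧ (λ i → linT (a i) xv) p ρ)
                       (⟦⟧t-cong p (λ i → ⟦∑T⟧ n (λ x → cst (a i x) ⊛ xv x) ρ))

    invT-unprimed : (p : Term (Fin m)) {ρ σ : Valuation (Sym n)} →
      (∀ x → ρ (inj₁ x) ≡ σ (inj₁ x)) → ⟦ invT a p ⟧t M ρ ≡ ⟦ invT a p ⟧t M σ
    invT-unprimed p {ρ} {σ} x≡ = begin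
      ⟦ invT a p ⟧t M ρ         ≡⟨ ⟦invT⟧ p ρ ⟩
      ⟦ p ⟧t M (invValuation ρ) ≡⟨ ⟦⟧t-cong p (λ i → sum-cong-≗ {n} (λ x → cong (_ *_) (x≡ x))) ⟩
      ⟦ p ⟧t M (invValuation σ) ≡⟨ sym (⟦invT⟧ p σ) ⟩
      ⟦ invT a p ⟧t M σ         ∎

    invT-step : {F : TF n} → (∀ i → InLinInv F (a i)) → (p : Term (Fin m))
      {ρ σ : Valuation (Sym n)} → ⟦ F ⟧ M ρ → (∀ x → σ (inj₁ x) ≡ ρ (inj₂ x)) →
      ⟦ invT a p ⟧t M σ ≡ ⟦ invT a p ⟧t M ρ
    invT-step invariant p {ρ} {σ} F✓ σ≡x' = begin
      ⟦ invT a p ⟧t M σ         ≡⟨ ⟦invT⟧ p σ ⟩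
      ⟦ p ⟧t M (invValuation σ) ≡⟨ ⟦⟧t-cong p preserved ⟩
      ⟦ p ⟧t M (invValuation ρ) ≡⟨ sym (⟦invT⟧ p ρ) ⟩
      ⟦ invT a p ⟧t M ρ         ∎
      where
      preserved : ∀ i → invValuation σ i ≡ invValuation ρ i
      preserved i = begin
        sum (λ x → ⟦ cst (a i x) ⟧t M σ * σ (inj₁ x)) ≡⟨ sum-cong-≗ {n} (λ x → cong (_ *_) (σ≡x' x)) ⟩
        sum (λ x → ⟦ cst (a i x) ⟧t M ρ * ρ (inj₂ x)) ≡⟨ sym (⟦∑T⟧ n (λ x → cst (a i x) ⊛ x'v x) ρ) ⟩
        ⟦ linT (a i) x'v ⟧t M ρ                        ≡⟨ invariant i M ρ F✓ ⟩
        ⟦ linT (a i) xv ⟧t M ρ                         ≡⟨ ⟦∑T⟧ n (λ x → cst (a i x) ⊛ xv x) ρ ⟩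
        sum (λ x → ⟦ cst (a i x) ⟧t M ρ * ρ (inj₁ x)) ∎

    ⟦cf⟧ : (p : DK n m) (ρ : Valuation (Sym n)) (τ : Carrier) →
      ⟦ cf a p ⟧t M [ ρ , (λ _ → τ) ]′ ≡ ⟦ δT a (πD p) ⟧t M ρ + τ * ⟦ invT a (πK p) ⟧t M ρ
    ⟦cf⟧ p ρ τ = cong₂ (λ u v → u + τ * v) (⟦renT⟧ inj₁ (δT a (πD p)) (λ _ → refl))
                                            (⟦renT⟧ inj₁ (invT a (πK p)) (λ _ → refl))

    module _ {F : TF n} where

      cone-iterate : (∀ i → InLinInv F (a i)) → (r : DK n m) → F ⊨ (cst 0ℚ ≼ δinv a r) →
        (t : ℕ) (ρ : Valuation (Sym n)) → ⟦ F ^ᶠ t ⟧ M ρ →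
        0# ≤ ⟦ δT a (πD r) ⟧t M ρ + ι (ℤ.+ t) * ⟦ invT a (πK r) ⟧t M ρ
      cone-iterate invariant r r≥0 zero ρ F⁰ =
        subst (0# ≤_) (sym no-progress) (≤-refl 0#)
        where
        no-progress : ⟦ δT a (πD r) ⟧t M ρ + 0# * ⟦ invT a (πK r) ⟧t M ρ ≡ 0#
        no-progress =
          trans (cong₂ _+_ (δT-vanishes (πD r) ρ (^ᶠ0-identity F F⁰)) (zeroˡ _)) (+-identityʳ 0#)
      cone-iterate invariant r r≥0 (suc t) ρ Fᵗ⁺¹ with ∘ᶠ-midpoint F (F ^ᶠ t) Fᵗ⁺¹
      ... | w , F✓ , Fᵗ✓ =
        subst (0# ≤_) regroup (+-nonneg first-step (cone-iterate invariant r r≥0 t end Fᵗ✓))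
        where
        start end : Valuation (Sym n)
        start = [ ρ ∘ inj₁ , w ]′
        end   = [ w , ρ ∘ inj₂ ]′
        c : Fin n → ℚ
        c = πD r
        p : Term (Fin m)
        p = πK r
        i : Carrier
        i = ⟦ invT a p ⟧t M ρ
        inv-start : ⟦ invT a p ⟧t M start ≡ i
        inv-start = invT-unprimed p (λ _ → refl)
        first-step : 0# ≤ ⟦ δT a c ⟧t M start + ⟦ invT a p ⟧t M start
        first-step = subst (_≤ ⟦ δinv a r ⟧t M start) (⟦cst0⟧ start) (r≥0 M start F✓)
        regroup : (⟦ δT a c ⟧t M start + ⟦ invT a p ⟧t M start) +
                  (⟦ δT a c ⟧t M end + ι (ℤ.+ t) * ⟦ invT a p ⟧t M end)
                ≡ ⟦ δT a c ⟧t M ρ + ι (ℤ.+ suc t) * i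
        regroup = begin
          (⟦ δT a c ⟧t M start + ⟦ invT a p ⟧t M start) +
          (⟦ δT a c ⟧t M end + ι (ℤ.+ t) * ⟦ invT a p ⟧t M end)
            ≡⟨ cong₂ (λ u v → (⟦ δT a c ⟧t M start + u) + (⟦ δT a c ⟧t M end + ι (ℤ.+ t) * v))
                     inv-start (trans (invT-step {F} invariant p F✓ (λ _ → refl)) inv-start) ⟩
          (⟦ δT a c ⟧t M start + i) + (⟦ δT a c ⟧t M end + ι (ℤ.+ t) * i)
            ≡⟨ comm∧assoc⇒middleFour +-comm +-assoc
                 (⟦ δT a c ⟧t M start) i (⟦ δT a c ⟧t M end) (ι (ℤ.+ t) * i) ⟩
          (⟦ δT a c ⟧t M start + ⟦ δT a c ⟧t M end) + (i + ι (ℤ.+ t) * i)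
            ≡⟨ cong₂ _+_ (δT-telescope c ρ w) (cong (_+ ι (ℤ.+ t) * i) (sym (*-identityˡ i))) ⟩
          ⟦ δT a c ⟧t M ρ + (1# * i + ι (ℤ.+ t) * i)
            ≡⟨ cong (⟦ δT a c ⟧t M ρ +_) (sym (distribʳ i 1# (ι (ℤ.+ t)))) ⟩
          ⟦ δT a c ⟧t M ρ + ι (ℤ.+ suc t) * i ∎

      ideal-iterate : (v : Term (Fin m)) → F ⊨ (cst 0ℚ ≐ invT a v) →
        (t : ℕ) (ρ : Valuation (Sym n)) → ⟦ F ^ᶠ t ⟧ M ρ → ι (ℤ.+ t) * ⟦ invT a v ⟧t M ρ ≡ 0#
      ideal-iterate v v≡0 zero ρ _ = zeroˡ _
      ideal-iterate v v≡0 (suc t) ρ Fᵗ⁺¹ with ∘ᶠ-midpoint F (F ^ᶠ t) Fᵗ⁺¹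
      ... | w , F✓ , _ = trans (cong (ι (ℤ.+ suc t) *_) vanishes) (zeroʳ _)
        where
        vanishes : ⟦ invT a v ⟧t M ρ ≡ 0#
        vanishes = begin
          ⟦ invT a v ⟧t M ρ                 ≡⟨ invT-unprimed v (λ _ → refl) ⟩
          ⟦ invT a v ⟧t M [ ρ ∘ inj₁ , w ]′ ≡⟨ sym (v≡0 M [ ρ ∘ inj₁ , w ]′ F✓) ⟩
          ⟦ cst 0ℚ ⟧t M [ ρ ∘ inj₁ , w ]′   ≡⟨ ⟦cst0⟧ [ ρ ∘ inj₁ , w ]′ ⟩
          0#                                ∎

      exp-iterate : (∀ i → InLinInv F (a i)) →
        {nv nr : ℕ} (V : Fin nv → Term (Fin m)) (R : Fin nr → DK n m) →
        (∀ j → F ⊨ (cst 0ℚ ≼ δinv a (R j))) → (∀ j → F ⊨ (cst 0ℚ ≐ invT a (V j))) →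
        (t : ℕ) (ρ : Valuation (Sym n)) → ⟦ F ^ᶠ t ⟧ M ρ →
        ⟦ expF a V R ⟧ M [ ρ , (λ _ → ι (ℤ.+ t)) ]′
      exp-iterate invariant {nv} {nr} V R R-valid V-valid t ρ Fᵗ =
        ⟦⋀⟧-intro nv _ V-equation , ⟦⋀⟧-intro nr _ R-inequality
        where
        τ : Carrier
        τ = ι (ℤ.+ t)
        ρτ : Valuation (Sym n ⊎ Fin 1)
        ρτ = [ ρ , (λ _ → τ) ]′
        V-equation : (j : Fin nv) → ⟦ cst 0ℚ ≐ cf a (dk (λ _ → 0ℚ) (V j)) ⟧ M ρτ
        V-equation j = trans (⟦cst0⟧ ρτ) (sym (begin
          ⟦ cf a (dk (λ _ → 0ℚ) (V j)) ⟧t M ρτ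
            ≡⟨ ⟦cf⟧ (dk (λ _ → 0ℚ) (V j)) ρ τ ⟩
          ⟦ δT a (λ _ → 0ℚ) ⟧t M ρ + τ * ⟦ invT a (V j) ⟧t M ρ
            ≡⟨ cong₂ _+_ (δT-zero ρ) (ideal-iterate (V j) (V-valid j) t ρ Fᵗ) ⟩
          0# + 0#
            ≡⟨ +-identityʳ 0# ⟩
          0# ∎))
        R-inequality : (j : Fin nr) → ⟦ cst 0ℚ ≼ cf a (R j) ⟧ M ρτ
        R-inequality j = subst₂ _≤_ (sym (⟦cst0⟧ ρτ)) (sym (⟦cf⟧ (R j) ρ τ))
          (cone-iterate invariant (R j) (R-valid j) t ρ Fᵗ)

theorem5p2 : {n : ℕ} (F : TF n) → PureF F →
    {m : ℕ} (a : Fin m → Fin n → ℚ) → IsBasisLinInv F a →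
    {nv nr : ℕ} (V : Fin nv → Term (Fin m)) (R : Fin nr → DK n m) →
    ((p : DK n m) → (InGen a V R p → F ⊨ (cst 0ℚ ≼ δinv a p)) ×
                    (F ⊨ (cst 0ℚ ≼ δinv a p) → InGen a V R p)) →
    ((j : Fin nv) → F ⊨ (cst 0ℚ ≐ invT a (V j))) →
    (t : ℕ) → (F ^ᶠ t) ⊨ star a V R
-- Neither the purity of F nor the completeness half of the description of Cn(F) is needed.
theorem5p2 F _ a (invariant , _) V R Cn-characterisation V-valid t M ρ Fᵗ =
  (λ _ → ι (ℤ.+ t)) , ι-Int t , subst (_≤ ι (ℤ.+ t)) (sym (⟦cst0⟧ ρ)) (ι-nonneg t) ,
  exp-iterate a {F} invariant V R R-valid V-valid t ρ Fᵗ
  where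
  open LIRR M
  open Semantics M
  R-valid : ∀ j → F ⊨ (cst 0ℚ ≼ δinv a (R j))
  R-valid j = proj₁ (Cn-characterisation (R j)) (InGen-generator a V R j)
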